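{- Let $f$ be an endomorphism of $\{a,b\}^*$ (with $a \prec b$) that preserves the lexicographic order on finite words. Assume that $f(ab^i)$ is a power of a Lyndon word $u$ for some integer $i \geq 1$, and assume also that $|u| > |f(b)|$ if $i = 1$. Then for every non-empty finite word $v$ over $\{a,b\}$ such that $ab^i v$ is a Lyndon word, the word $f(ab^i v)$ is also a Lyndon word.
   Context: The lexicographic order $\prec$ on finite words over $\{a \prec b\}$: $u \prec v$ iff $u$ is a proper prefix of $v$, or $u = x\alpha y$, $v = x\beta z$ with letters $\alpha \prec \beta$. A non-empty finite word $w$ is a Lyndon word if $w \prec s$ for every non-empty proper suffix $s$ of $w$. $f$ preserves the lexicographic order on finite words if for all finite words $u,v$, $u \prec v$ implies $f(u) \prec f(v)$. A power of $u$ means $u^n$ for an integer $n \ge 1$; $|w|$ is the length of $w$. -}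

module Defs where

open import Data.Nat using (ℕ; zero; suc; _≥_; _>_)
open import Data.List using (List; []; _∷_; _++_; concatMap; replicate; length; concat)
open import Data.Product using (∃; _×_; _,_)
open import Relation.Binary.PropositionalEquality using (_≡_)
open import Relation.Nullary using (¬_)

data Letter : Set where
  a b : Letter

data _<L_ : Letter → Letter → Set where
  a<b : a <L b

Word : Set
Word = List Letter

data _≺_ : Word → Word → Set where
  prefix : ∀ {α v} → [] ≺ (α ∷ v)
  differ : ∀ {α β u v} → α <L β → (α ∷ u) ≺ (β ∷ v)
  same   : ∀ {α u v} → u ≺ v → (α ∷ u) ≺ (α ∷ v)

NonEmpty : Word → Set
NonEmpty w = ¬ (w ≡ [])

ProperSuffix : Word → Word → Set
ProperSuffix s w = NonEmpty s × ∃ λ p → NonEmpty p × (w ≡ p ++ s)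

Lyndon : Word → Set
Lyndon w = NonEmpty w × (∀ s → ProperSuffix s w → w ≺ s)

_^_ : Word → ℕ → Word
u ^ n = concat (replicate n u)

IsPowerOf : Word → Word → Set
IsPowerOf w u = ∃ λ n → n ≥ 1 × w ≡ u ^ n

Endo : Set
Endo = Letter → Word

apply : Endo → Word → Word
apply σ w = concatMap σ w

PreservesLex : Endo → Set
PreservesLex σ = ∀ u v → u ≺ v → apply σ u ≺ apply σ v

-- Let F(a bⁱ) = uᴷ, so that F(a bⁱ v) = uᴷ F(v), and let s be a proper suffix of this
-- image. If s starts at the image of a letter, s = F(w′) for a proper suffix w′ of
-- w = a bⁱ v and order preservation gives F(w) ≺ s. If s starts strictly inside F(b),
-- it starts with a proper suffix of u (because |F(b)| < |u|, which for i ≥ 2 follows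
-- from F(a bⁱ) ≺ F(b)), and a Lyndon word is below its proper suffixes by a mismatch.
-- If s starts strictly inside F(a), the Lyndon property of w forces that a to be
-- followed by bⁱ v′ with v ≼ v′ and w ≺ v′; then s is either uʲ F(v′), and F(w) ≺ s
-- reduces to uᵐ F(v) ≺ F(v′), or again starts with a proper suffix of u.

module Submission where

open import Defs
open import Data.Nat using (ℕ; zero; suc; _+_; _≤_; _<_; _≥_; _>_; z≤n; s≤s; _<?_)
open import Data.Nat.Properties using (≤-trans; <-trans; m≤m+n; <⇒≱; ≮⇒≥; +-comm; m≢1+n+m)
open import Data.List using ([]; _∷_; _++_; replicate; length; concat)
open import Data.List.Properties
  using (∷-injective; ∷-injectiveʳ; ++-assoc; ++-identityʳ; ++-identityˡ-unique; ++-conicalˡ; ++-monoid;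
         length-++; length-++-sucʳ; length-++-comm; length-++-≤ˡ; length-++-≤ʳ; concatMap-++; map-replicate)
open import Data.Product using (∃; ∃₂; _×_; _,_; proj₁; proj₂)
open import Data.Sum as Sum using (_⊎_; inj₁; inj₂)
open import Data.Empty using (⊥-elim)
open import Relation.Nullary using (¬_; yes; no)
open import Relation.Binary.PropositionalEquality
  using (_≡_; refl; sym; trans; cong; subst; subst₂; module ≡-Reasoning)
open import Tactic.MonoidSolver using (solve)

++-equidivisible : ∀ (P S X Y : Word) → P ++ S ≡ X ++ Y →
  (∃ λ Q → P ≡ X ++ Q × Y ≡ Q ++ S) ⊎ (∃ λ Q → NonEmpty Q × X ≡ P ++ Q × S ≡ Q ++ Y)
++-equidivisible P       S []      Y e = inj₁ (P , refl , sym e)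
++-equidivisible []      S (x ∷ X) Y e = inj₂ (x ∷ X , (λ ()) , refl , e)
++-equidivisible (p ∷ P) S (x ∷ X) Y e with ∷-injective e
... | refl , e′ with ++-equidivisible P S X Y e′
...   | inj₁ (Q , eP , eY)         = inj₁ (Q , cong (p ∷_) eP , eY)
...   | inj₂ (Q , Q≢[] , eX , eS) = inj₂ (Q , Q≢[] , cong (p ∷_) eX , eS)

suffix-unique : ∀ (A B C D : Word) → A ++ B ≡ C ++ D → length B ≡ length D → B ≡ D
suffix-unique []      B []      D e _ = e
suffix-unique []      B (c ∷ C) D e l =
  ⊥-elim (m≢1+n+m (length D) (trans (sym l) (trans (cong length e) (cong suc (length-++ C)))))
suffix-unique (c ∷ A) B []      D e l =
  ⊥-elim (m≢1+n+m (length B) (trans l (trans (cong length (sym e)) (cong suc (length-++ A)))))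
suffix-unique (c ∷ A) B (d ∷ C) D e l = suffix-unique A B C D (∷-injectiveʳ e) l

proper-suffix-shorter : ∀ {r} s → NonEmpty r → length s < length (r ++ s)
proper-suffix-shorter {[]}    s r≢[] = ⊥-elim (r≢[] refl)
proper-suffix-shorter {_ ∷ r} s _    = s≤s (length-++-≤ʳ s {r})

proper-prefix-shorter : ∀ r {s} → NonEmpty s → length r < length (r ++ s)
proper-prefix-shorter r {[]}    s≢[] = ⊥-elim (s≢[] refl)
proper-prefix-shorter r {c ∷ s} _    = subst (length r <_) (sym (length-++-sucʳ r c s)) (s≤s (length-++-≤ˡ r))

^-+ : ∀ u m n → u ^ (m + n) ≡ u ^ m ++ u ^ n
^-+ u zero    n = refl
^-+ u (suc m) n = trans (cong (u ++_) (^-+ u m n)) (sym (++-assoc u (u ^ m) (u ^ n)))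

^-sucʳ : ∀ u n → u ^ suc n ≡ u ^ n ++ u
^-sucʳ u n = begin
  u ^ suc n          ≡⟨ cong (u ^_) (+-comm 1 n) ⟩
  u ^ (n + 1)        ≡⟨ ^-+ u n 1 ⟩
  u ^ n ++ (u ++ []) ≡⟨ cong (u ^ n ++_) (++-identityʳ u) ⟩
  u ^ n ++ u         ∎
  where open ≡-Reasoning

apply-replicate : ∀ σ n c → apply σ (replicate n c) ≡ σ c ^ n
apply-replicate σ n c = cong concat (map-replicate σ n c)

≺-irrefl : ∀ x → ¬ (x ≺ x)
≺-irrefl (_ ∷ x) (differ ())
≺-irrefl (_ ∷ x) (same x≺x) = ≺-irrefl x x≺x

≺-trans : ∀ {x y z} → x ≺ y → y ≺ z → x ≺ z
≺-trans prefix     (differ _)  = prefix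
≺-trans prefix     (same _)    = prefix
≺-trans (differ a<b) (differ ())
≺-trans (differ α<β) (same _)  = differ α<β
≺-trans (same _)   (differ β<γ) = differ β<γ
≺-trans (same x≺y) (same y≺z)  = same (≺-trans x≺y y≺z)

≺-compare : ∀ x y → x ≺ y ⊎ x ≡ y ⊎ y ≺ x
≺-compare []      []      = inj₂ (inj₁ refl)
≺-compare []      (_ ∷ _) = inj₁ prefix
≺-compare (_ ∷ _) []      = inj₂ (inj₂ prefix)
≺-compare (a ∷ x) (b ∷ y) = inj₁ (differ a<b)
≺-compare (b ∷ x) (a ∷ y) = inj₂ (inj₂ (differ a<b))
≺-compare (a ∷ x) (a ∷ y) = Sum.map same (Sum.map (cong (a ∷_)) same) (≺-compare x y)
≺-compare (b ∷ x) (b ∷ y) = Sum.map same (Sum.map (cong (b ∷_)) same) (≺-compare x y)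

≺-nonempty : ∀ {x y} → x ≺ y → NonEmpty y
≺-nonempty prefix     ()
≺-nonempty (differ _) ()
≺-nonempty (same _)   ()

≺-∷⁻ : ∀ {α x y} → (α ∷ x) ≺ (α ∷ y) → x ≺ y
≺-∷⁻ (differ ())
≺-∷⁻ (same x≺y) = x≺y

++-monoʳ-≺ : ∀ x {p q} → p ≺ q → (x ++ p) ≺ (x ++ q)
++-monoʳ-≺ []      p≺q = p≺q
++-monoʳ-≺ (_ ∷ x) p≺q = same (++-monoʳ-≺ x p≺q)

≺-++ʳ : ∀ x {r} → NonEmpty r → x ≺ (x ++ r)
≺-++ʳ []      {[]}    r≢[] = ⊥-elim (r≢[] refl)
≺-++ʳ []      {_ ∷ _} _    = prefix
≺-++ʳ (_ ∷ x)         r≢[] = same (≺-++ʳ x r≢[])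

++-≮ : ∀ x r → ¬ ((x ++ r) ≺ x)
++-≮ []      r ()
++-≮ (_ ∷ x) r (differ ())
++-≮ (_ ∷ x) r (same xr≺x) = ++-≮ x r xr≺x

-- A comparison decided within the length of y survives any extension of both words.
≺-extend : ∀ {x y} → x ≺ y → length y ≤ length x → ∀ z z′ → (x ++ z) ≺ (y ++ z′)
≺-extend prefix       ()
≺-extend (differ α<β) _         z z′ = differ α<β
≺-extend (same x≺y)   (s≤s y≤x) z z′ = same (≺-extend x≺y y≤x z z′)

_≼_ : Word → Word → Set
x ≼ y = x ≺ y ⊎ x ≡ y

≼-≺-trans : ∀ {x y z} → x ≼ y → y ≺ z → x ≺ z
≼-≺-trans (inj₁ x≺y) y≺z = ≺-trans x≺y y≺z
≼-≺-trans (inj₂ refl) y≺z = y≺z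

≺-≼-trans : ∀ {x y z} → x ≺ y → y ≼ z → x ≺ z
≺-≼-trans x≺y (inj₁ y≺z) = ≺-trans x≺y y≺z
≺-≼-trans x≺y (inj₂ refl) = x≺y

++-monoʳ-≼ : ∀ x {p q} → p ≼ q → (x ++ p) ≼ (x ++ q)
++-monoʳ-≼ x (inj₁ p≺q) = inj₁ (++-monoʳ-≺ x p≺q)
++-monoʳ-≼ x (inj₂ refl) = inj₂ refl

data PowerCut (u : Word) (k : ℕ) (P T : Word) : Set where
  aligned : ∀ m j → k ≡ m + j → P ≡ u ^ m → T ≡ u ^ j → PowerCut u k P T
  inside  : ∀ m j {r s} → NonEmpty r → NonEmpty s → u ≡ r ++ s →
            P ≡ u ^ m ++ r → T ≡ s ++ u ^ j → PowerCut u k P T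

powerCut : ∀ u k P T → u ^ k ≡ P ++ T → PowerCut u k P T
powerCut u zero    []      T e  = aligned 0 0 refl refl (sym e)
powerCut u zero    (_ ∷ _) T ()
powerCut u (suc k) P       T e with ++-equidivisible P T u (u ^ k) (sym e)
... | inj₁ (Q , refl , eQ) with powerCut u k Q T eQ
...   | aligned m j ek refl eT = aligned (suc m) j (cong suc ek) refl eT
...   | inside m j {r} r≢[] s≢[] eu refl eT =
        inside (suc m) j r≢[] s≢[] eu (sym (++-assoc u (u ^ m) r)) eT
powerCut u (suc k) []      T e | inj₂ _ = aligned 0 (suc k) refl refl (sym e)
powerCut u (suc k) (c ∷ P) T e | inj₂ (Q , Q≢[] , eu , eT) = inside 0 k (λ ()) Q≢[] eu refl eT

short-suffix-of-power : ∀ u k {P t} → u ^ k ≡ P ++ t → NonEmpty t → length t < length u →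
                        ∃ λ r → NonEmpty r × u ≡ r ++ t
short-suffix-of-power u k {P} {t} e t≢[] t<u with powerCut u k P t e
... | aligned _ zero    _ _ refl = ⊥-elim (t≢[] refl)
... | aligned _ (suc j) _ _ refl = ⊥-elim (<⇒≱ t<u (length-++-≤ˡ u))
... | inside _ zero {r} r≢[] _ eu _ refl = r , r≢[] , trans eu (cong (r ++_) (sym (++-identityʳ _)))
... | inside _ (suc j) {s = s} _ _ _ _ refl =
      ⊥-elim (<⇒≱ t<u (≤-trans (length-++-≤ˡ u) (length-++-≤ʳ (u ^ suc j) {s})))

long-suffix-of-power : ∀ {u} k {P T} → NonEmpty u → u ^ k ≡ P ++ T → length u ≤ length T →
                       ∃ λ T′ → T ≡ T′ ++ u
long-suffix-of-power {[]}    k u≢[] e u≤T = ⊥-elim (u≢[] refl)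
long-suffix-of-power {c ∷ u} k {P} {T} _ e u≤T with powerCut (c ∷ u) k P T e
... | aligned _ zero    _ _ refl = ⊥-elim (<⇒≱ (s≤s z≤n) u≤T)
... | aligned _ (suc j) _ _ refl = (c ∷ u) ^ j , ^-sucʳ (c ∷ u) j
... | inside _ zero {r} {s} r≢[] _ eu _ refl =
      ⊥-elim (<⇒≱ (subst (λ z → length s < length z) (sym eu) (proper-suffix-shorter s r≢[]))
                  (subst (λ z → length (c ∷ u) ≤ length z) (++-identityʳ s) u≤T))
... | inside _ (suc j) {s = s} _ _ _ _ refl =
      s ++ (c ∷ u) ^ j , trans (cong (s ++_) (^-sucʳ (c ∷ u) j)) (sym (++-assoc s _ (c ∷ u)))

^-++-descending : ∀ {u G} → (u ++ G) ≺ G → ∀ n → (u ^ suc n ++ G) ≺ G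
^-++-descending {u} {G} uG≺G zero    = subst (λ z → (z ++ G) ≺ G) (sym (++-identityʳ u)) uG≺G
^-++-descending {u} {G} uG≺G (suc n) =
  subst (_≺ G) (sym (++-assoc u (u ^ suc n) G)) (≺-trans (++-monoʳ-≺ u (^-++-descending uG≺G n)) uG≺G)

^-++-ascending : ∀ {u G m k} → G ≺ (u ++ G) → m ≤ k → (u ^ m ++ G) ≼ (u ^ k ++ G)
^-++-ascending {k = zero}        G≺uG z≤n = inj₂ refl
^-++-ascending {u} {G} {k = suc k} G≺uG z≤n =
  inj₁ (subst (G ≺_) (sym (++-assoc u (u ^ k) G)) (≺-≼-trans G≺uG (++-monoʳ-≼ u (^-++-ascending {k = k} G≺uG z≤n))))
^-++-ascending {u} {G} {suc m} {suc k} G≺uG (s≤s m≤k) =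
  subst₂ _≼_ (sym (++-assoc u (u ^ m) G)) (sym (++-assoc u (u ^ k) G)) (++-monoʳ-≼ u (^-++-ascending G≺uG m≤k))

-- Whether u ^ n ++ G decreases or increases with n, the intermediate powers lie below Z.
power-++-≺ : ∀ {u G Z m k} → NonEmpty u → 1 ≤ m → m ≤ k → (u ^ k ++ G) ≺ Z → G ≼ Z → (u ^ m ++ G) ≺ Z
power-++-≺ {u} {G} {m = suc m} u≢[] _ m≤k uᵏG≺Z G≼Z with ≺-compare (u ++ G) G
... | inj₁ uG≺G        = ≺-≼-trans (^-++-descending uG≺G m) G≼Z
... | inj₂ (inj₁ uG≡G) = ⊥-elim (u≢[] (++-identityˡ-unique u (sym uG≡G)))
... | inj₂ (inj₂ G≺uG) = ≼-≺-trans (^-++-ascending G≺uG m≤k) uᵏG≺Z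

lyndon-≺-++ : ∀ {u r s} → Lyndon u → u ≡ r ++ s → NonEmpty r → NonEmpty s → ∀ Z Z′ → (u ++ Z) ≺ (s ++ Z′)
lyndon-≺-++ {r = r} {s} (_ , least) refl r≢[] s≢[] =
  ≺-extend (least s (s≢[] , r , r≢[] , refl)) (length-++-≤ʳ s {r})

lyndon-¬rotation : ∀ {u r s} → Lyndon u → u ≡ r ++ s → NonEmpty r → NonEmpty s → ¬ (s ++ r ≡ u)
lyndon-¬rotation {r = r} {s} (_ , least) eu r≢[] s≢[] refl =
  ≺-irrefl s (≺-trans (≺-++ʳ s r≢[]) (least s (s≢[] , r , r≢[] , eu)))

-- A misaligned cut would exhibit u as a nontrivial rotation of itself.
lyndon-power-cut-aligned : ∀ {u} k P T → Lyndon u → u ^ k ≡ (P ++ u) ++ T → ∃₂ λ m j → k ≡ m + j × T ≡ u ^ j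
lyndon-power-cut-aligned {u} k P T L e with powerCut u k (P ++ u) T e
... | aligned m j ek _ eT = m , j , ek , eT
... | inside zero j {r} r≢[] s≢[] eu eP _ =
      ⊥-elim (<⇒≱ (subst (λ z → length r < length z) (sym eu) (proper-prefix-shorter r s≢[]))
                  (subst (λ z → length u ≤ length z) eP (length-++-≤ʳ u {P})))
... | inside (suc m) j {r} {s} r≢[] s≢[] eu eP _ =
      ⊥-elim (lyndon-¬rotation L eu r≢[] s≢[] (sym (suffix-unique P u (u ^ m ++ r) (s ++ r) P-u≡ |u|≡)))
  where
  open ≡-Reasoning
  P-u≡ : P ++ u ≡ (u ^ m ++ r) ++ (s ++ r)
  P-u≡ = begin
    P ++ u                   ≡⟨ eP ⟩
    u ^ suc m ++ r           ≡⟨ cong (_++ r) (^-sucʳ u m) ⟩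
    (u ^ m ++ u) ++ r        ≡⟨ cong (λ z → (u ^ m ++ z) ++ r) eu ⟩
    (u ^ m ++ (r ++ s)) ++ r ≡⟨ solve (++-monoid Letter) ⟩
    (u ^ m ++ r) ++ (s ++ r) ∎
  |u|≡ : length u ≡ length (s ++ r)
  |u|≡ = trans (cong length eu) (length-++-comm r s)

-- Were y as long as u, it would end in u, so uᵏ = x y y would be cut in alignment
-- before the last y, making y a power of u and hence a prefix of uᵏ.
repeated-suffix-shorter : ∀ {u x y} k n → Lyndon u → u ^ k ≡ x ++ y ^ suc (suc n) → (u ^ k) ≺ y →
                          length y < length u
repeated-suffix-shorter {u} {x} {y} k n L e uᵏ≺y with length y <? length u
... | yes y<u = y<u
... | no y≮u with long-suffix-of-power k {x ++ y ^ suc n} {y} (proj₁ L) uᵏ-split (≮⇒≥ y≮u)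
  where
  uᵏ-split : u ^ k ≡ (x ++ y ^ suc n) ++ y
  uᵏ-split = trans e (trans (cong (x ++_) (^-sucʳ y (suc n))) (sym (++-assoc x (y ^ suc n) y)))
...   | y′ , y≡y′u with lyndon-power-cut-aligned k (x ++ y ^ n ++ y′) y L uᵏ-split′
  where
  open ≡-Reasoning
  uᵏ-split′ : u ^ k ≡ ((x ++ y ^ n ++ y′) ++ u) ++ y
  uᵏ-split′ = begin
    u ^ k                            ≡⟨ e ⟩
    x ++ y ^ suc (suc n)             ≡⟨ cong (x ++_) (^-sucʳ y (suc n)) ⟩
    x ++ (y ^ suc n ++ y)            ≡⟨ cong (λ z → x ++ (z ++ y)) (^-sucʳ y n) ⟩
    x ++ ((y ^ n ++ y) ++ y)         ≡⟨ cong (λ z → x ++ ((y ^ n ++ z) ++ y)) y≡y′u ⟩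
    x ++ ((y ^ n ++ (y′ ++ u)) ++ y) ≡⟨ solve (++-monoid Letter) ⟩
    ((x ++ y ^ n ++ y′) ++ u) ++ y   ∎
...     | m , j , refl , y≡uʲ =
          ⊥-elim (++-≮ (u ^ j) (u ^ m) (subst₂ _≺_ (trans (cong (u ^_) (+-comm m j)) (^-+ u j m)) y≡uʲ uᵏ≺y))

replicate-b-≺ : ∀ n {x z} → (replicate n b ++ x) ≺ z → ∃ λ z′ → z ≡ replicate n b ++ z′ × x ≺ z′
replicate-b-≺ zero    x≺z = _ , refl , x≺z
replicate-b-≺ (suc n) (differ ())
replicate-b-≺ (suc n) (same bⁿx≺z) with replicate-b-≺ n bⁿx≺z
... | z′ , refl , x≺z′ = z′ , refl , x≺z′

a-occurrence-in-lyndon : ∀ n {v p₀ w′} → Lyndon (a ∷ replicate n b ++ v) → NonEmpty v →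
                         a ∷ replicate n b ++ v ≡ p₀ ++ a ∷ w′ →
                         ∃ λ v′ → w′ ≡ replicate n b ++ v′ × ProperSuffix v′ (a ∷ replicate n b ++ v) × v ≼ v′
a-occurrence-in-lyndon n {v} {[]} _ v≢[] refl = v , refl , (v≢[] , a ∷ replicate n b , (λ ()) , refl) , inj₂ refl
a-occurrence-in-lyndon n {v} {q ∷ p₀} {w′} (_ , least) _ e
  with replicate-b-≺ n (≺-∷⁻ (least (a ∷ w′) ((λ ()) , q ∷ p₀ , (λ ()) , e)))
... | v′ , refl , v≺v′ =
      v′ , refl , (≺-nonempty v≺v′ , q ∷ p₀ ++ a ∷ replicate n b , (λ ()) , trans e (sym (++-assoc (q ∷ p₀) _ v′))) , inj₁ v≺v′

-- The suffix s of σ(w) = p ++ s starts inside the image of the letter c of w ≡ p₀ ++ c ∷ w′.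
data ImageCut (σ : Endo) (w p s : Word) : Set where
  cut : ∀ p₀ c w′ t′ {t} → NonEmpty t → w ≡ p₀ ++ c ∷ w′ → σ c ≡ t′ ++ t →
        p ≡ apply σ p₀ ++ t′ → s ≡ t ++ apply σ w′ → ImageCut σ w p s

imageCut : ∀ σ w p s → apply σ w ≡ p ++ s → NonEmpty s → ImageCut σ w p s
imageCut σ []      []      s e s≢[] = ⊥-elim (s≢[] (sym e))
imageCut σ []      (_ ∷ _) s ()
imageCut σ (c ∷ w) p       s e s≢[] with ++-equidivisible p s (σ c) (apply σ w) (sym e)
... | inj₁ (Q , refl , eQ) with imageCut σ w Q s eQ s≢[]
...   | cut p₀ d w′ t′ t≢[] refl eσ refl es =
        cut (c ∷ p₀) d w′ t′ t≢[] refl eσ (sym (++-assoc (σ c) (apply σ p₀) t′)) es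
imageCut σ (c ∷ w) p s e s≢[] | inj₂ (Q , Q≢[] , eσ , es) = cut [] c w p Q≢[] refl eσ refl es

module LyndonImage (σ : Endo) (preserves : PreservesLex σ) (n k : ℕ) {u v : Word} (u-lyndon : Lyndon u)
  (image : apply σ (a ∷ replicate (suc n) b) ≡ u ^ suc k) (σb<u : length (σ b) < length u)
  (v≢[] : NonEmpty v) (w-lyndon : Lyndon (a ∷ replicate (suc n) b ++ v)) where

  open ≡-Reasoning

  F : Word → Word
  F = apply σ

  bⁱ : Word
  bⁱ = replicate (suc n) b

  w : Word
  w = a ∷ bⁱ ++ v

  F-w : F w ≡ u ^ suc k ++ F v
  F-w = trans (concatMap-++ σ (a ∷ bⁱ) v) (cong (_++ F v) image)

  F-w-u : F w ≡ u ++ (u ^ k ++ F v)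
  F-w-u = trans F-w (++-assoc u (u ^ k) (F v))

  uᴷ-split : u ^ suc k ≡ σ a ++ σ b ^ suc n
  uᴷ-split = trans (sym image) (cong (σ a ++_) (apply-replicate σ (suc n) b))

  F-w≺F : ∀ {s} → ProperSuffix s w → F w ≺ F s
  F-w≺F s-suffix = preserves w _ (proj₂ w-lyndon _ s-suffix)

  F-≼ : ∀ {x y} → x ≼ y → F x ≼ F y
  F-≼ = Sum.map (preserves _ _) (cong F)

  cut-in-b : ∀ {t′ t} → NonEmpty t′ → σ b ≡ t′ ++ t → NonEmpty t → ∀ Z → F w ≺ (t ++ Z)
  cut-in-b {t′} {t} t′≢[] eσ t≢[] Z =
    let r , r≢[] , eu = short-suffix-of-power u (suc k) uᴷ-split′ t≢[] t<u
    in subst (_≺ (t ++ Z)) (sym F-w-u) (lyndon-≺-++ u-lyndon eu r≢[] t≢[] _ Z)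
    where
    t<u : length t < length u
    t<u = <-trans (subst (λ z → length t < length z) (sym eσ) (proper-suffix-shorter t t′≢[])) σb<u
    uᴷ-split′ : u ^ suc k ≡ (σ a ++ σ b ^ n ++ t′) ++ t
    uᴷ-split′ = begin
      u ^ suc k                       ≡⟨ uᴷ-split ⟩
      σ a ++ σ b ^ suc n              ≡⟨ cong (σ a ++_) (^-sucʳ (σ b) n) ⟩
      σ a ++ (σ b ^ n ++ σ b)         ≡⟨ cong (λ z → σ a ++ (σ b ^ n ++ z)) eσ ⟩
      σ a ++ (σ b ^ n ++ (t′ ++ t))   ≡⟨ solve (++-monoid Letter) ⟩
      (σ a ++ σ b ^ n ++ t′) ++ t     ∎

  cut-in-a-with-bⁱ : ∀ {t′ t v′} → NonEmpty t′ → σ a ≡ t′ ++ t → F w ≺ F v′ → F v ≼ F v′ →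
                     F w ≺ (t ++ F (bⁱ ++ v′))
  cut-in-a-with-bⁱ {t′} {t} {v′} t′≢[] eσ F-w≺F-v′ F-v≼F-v′ =
    subst (F w ≺_) (sym F-suffix) (by-cut (powerCut u (suc k) t′ (t ++ σ b ^ suc n) uᴷ-split′))
    where
    F-suffix : t ++ F (bⁱ ++ v′) ≡ (t ++ σ b ^ suc n) ++ F v′
    F-suffix = begin
      t ++ F (bⁱ ++ v′)             ≡⟨ cong (t ++_) (concatMap-++ σ bⁱ v′) ⟩
      t ++ (F bⁱ ++ F v′)           ≡⟨ cong (λ z → t ++ (z ++ F v′)) (apply-replicate σ (suc n) b) ⟩
      t ++ (σ b ^ suc n ++ F v′)    ≡⟨ ++-assoc t _ (F v′) ⟨
      (t ++ σ b ^ suc n) ++ F v′    ∎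
    uᴷ-split′ : u ^ suc k ≡ t′ ++ (t ++ σ b ^ suc n)
    uᴷ-split′ = trans uᴷ-split (trans (cong (_++ σ b ^ suc n) eσ) (++-assoc t′ t _))
    by-cut : PowerCut u (suc k) t′ (t ++ σ b ^ suc n) → F w ≺ ((t ++ σ b ^ suc n) ++ F v′)
    by-cut (aligned zero _ _ t′≡[] _) = ⊥-elim (t′≢[] t′≡[])
    by-cut (aligned (suc m) j K≡ _ eT) =
      subst₂ _≺_ (sym F-w≡) (cong (_++ F v′) (sym eT)) (++-monoʳ-≺ (u ^ j) uᵐF-v≺F-v′)
      where
      F-w≡ : F w ≡ u ^ j ++ (u ^ suc m ++ F v)
      F-w≡ = begin
        F w                        ≡⟨ F-w ⟩
        u ^ suc k ++ F v           ≡⟨ cong (λ z → u ^ z ++ F v) (trans K≡ (+-comm (suc m) j)) ⟩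
        u ^ (j + suc m) ++ F v     ≡⟨ cong (_++ F v) (^-+ u j (suc m)) ⟩
        (u ^ j ++ u ^ suc m) ++ F v ≡⟨ ++-assoc (u ^ j) _ (F v) ⟩
        u ^ j ++ (u ^ suc m ++ F v) ∎
      uᵐF-v≺F-v′ : (u ^ suc m ++ F v) ≺ F v′
      uᵐF-v≺F-v′ = power-++-≺ (proj₁ u-lyndon) (s≤s z≤n) (subst (suc m ≤_) (sym K≡) (m≤m+n (suc m) j))
                              (subst (_≺ F v′) F-w F-w≺F-v′) F-v≼F-v′
    by-cut (inside m j {s = s} r≢[] s≢[] eu _ eT) =
      subst₂ _≺_ (sym F-w-u) (sym (trans (cong (_++ F v′) eT) (++-assoc s _ (F v′))))
             (lyndon-≺-++ u-lyndon eu r≢[] s≢[] _ _)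

  cut-in-a : ∀ {p₀ w′ t′ t} → w ≡ p₀ ++ a ∷ w′ → NonEmpty t′ → σ a ≡ t′ ++ t → F w ≺ (t ++ F w′)
  cut-in-a ew t′≢[] eσ with a-occurrence-in-lyndon (suc n) w-lyndon v≢[] ew
  ... | _ , refl , v′-suffix , v≼v′ = cut-in-a-with-bⁱ t′≢[] eσ (F-w≺F v′-suffix) (F-≼ v≼v′)

  ≺-proper-suffix : ∀ {p s} → NonEmpty p → F w ≡ p ++ s → NonEmpty s → F w ≺ s
  ≺-proper-suffix {p} {s} p≢[] e s≢[] with imageCut σ w p s e s≢[]
  ... | cut []       c w′ []      _   _  _  refl _    = ⊥-elim (p≢[] refl)
  ... | cut (q ∷ p₀) c w′ []      _   ew eσ _    refl =
        subst (λ z → F w ≺ (z ++ F w′)) eσ (F-w≺F ((λ ()) , q ∷ p₀ , (λ ()) , ew))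
  ... | cut p₀       b w′ (_ ∷ _) t≢[] _  eσ _    refl = cut-in-b (λ ()) eσ t≢[] (F w′)
  ... | cut p₀       a w′ (_ ∷ _) _   ew eσ _    refl = cut-in-a ew (λ ()) eσ

  image-lyndon : Lyndon (F w)
  image-lyndon = F-w≢[] , λ s (s≢[] , p , p≢[] , e) → ≺-proper-suffix p≢[] e s≢[]
    where
    F-w≢[] : NonEmpty (F w)
    F-w≢[] e = proj₁ u-lyndon (++-conicalˡ u _ (trans (sym F-w-u) e))

image-b-shorter : ∀ {σ u} n k → PreservesLex σ → Lyndon u → apply σ (a ∷ replicate (suc (suc n)) b) ≡ u ^ k →
                  length (σ b) < length u
image-b-shorter {σ} n k preserves L image =
  repeated-suffix-shorter {x = σ a} k n L (trans (sym image) (cong (σ a ++_) (apply-replicate σ (suc (suc n)) b)))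
    (subst₂ _≺_ image (++-identityʳ (σ b)) (preserves (a ∷ replicate (suc (suc n)) b) (b ∷ []) (differ a<b)))

lemma5 : (σ : Endo) → PreservesLex σ → (i : ℕ) → i ≥ 1 → (u : Word) → Lyndon u
         → IsPowerOf (apply σ (a ∷ replicate i b)) u
         → (i ≡ 1 → length u > length (σ b))
         → (v : Word) → NonEmpty v → Lyndon (a ∷ replicate i b ++ v)
         → Lyndon (apply σ (a ∷ replicate i b ++ v))
lemma5 σ preserves zero () _ _ _ _ _ _ _
lemma5 σ preserves (suc n) _ _ _ (zero , () , _) _ _ _ _
lemma5 σ preserves 1 _ _ L (suc k , _ , image) i≡1⇒σb<u _ v≢[] w-lyndon =
  LyndonImage.image-lyndon σ preserves 0 k L image (i≡1⇒σb<u refl) v≢[] w-lyndon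
lemma5 σ preserves (suc (suc n)) _ _ L (suc k , _ , image) _ _ v≢[] w-lyndon =
  LyndonImage.image-lyndon σ preserves (suc n) k L image (image-b-shorter n (suc k) preserves L image) v≢[] w-lyndon
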